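{- Let $T$ be a tree with $k$ flexible vertices. If $T$ has $x$ critical $3$-paths and $\frac{k-3x}{2}$ insulated $\alpha_3$-critical edges, then $T$ has at most $3^x\cdot 2^{\frac{k-3x}{2}}$ maximum dissociation sets.
   Context: A dissociation set of a graph $G$ is a set $S$ of vertices such that $G[S]$ has maximum degree at most $1$; a maximum dissociation set is one of maximum cardinality, which is denoted $\alpha_3(G)$. A vertex is flexible if it belongs to some but not all maximum dissociation sets. An edge $e$ is $\alpha_3$-critical if $\alpha_3(G-e)>\alpha_3(G)$, where $G-e$ is obtained by deleting $e$. An $\alpha_3$-critical edge is insulated if it shares no end-vertex with any other $\alpha_3$-critical edge. A critical $3$-path is a subgraph isomorphic to the path on $3$ vertices both of whose edges are $\alpha_3$-critical. -}

module Defs where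

open import Data.Nat using (ℕ; zero; suc; _≤_; _<_)
open import Data.Bool using (Bool; true; false)
open import Data.Fin using (Fin; toℕ)
open import Data.Fin.Subset using (Subset; _∈_; _∉_; _∩_; ∣_∣)
open import Data.Vec using (tabulate)
open import Data.List using (List; []; _∷_; length)
open import Data.List.Relation.Unary.Unique.Propositional using (Unique)
import Data.List.Membership.Propositional as LM
open import Data.Product using (Σ; ∃; _×_; _,_)
open import Data.Sum using (_⊎_)
open import Relation.Nullary using (¬_)
open import Relation.Binary.PropositionalEquality using (_≡_; _≢_)
open import Function.Bundles using (_⇔_)

record Graph (n : ℕ) : Set where
  field
    adj    : Fin n → Fin n → Bool
    sym    : ∀ u v → adj u v ≡ adj v u
    irrefl : ∀ v → adj v v ≡ false
open Graph public

module _ {n : ℕ} (G : Graph n) where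

  Adj : Fin n → Fin n → Set
  Adj u v = adj G u v ≡ true

  nbhd : Fin n → Subset n
  nbhd v = tabulate (adj G v)

  data Walk : Fin n → Fin n → Set where
    here : ∀ {v} → Walk v v
    step : ∀ {u v w} → Adj u v → Walk v w → Walk u w

  Connected : Set
  Connected = ∀ u v → Walk u v

  PathFrom : Fin n → List (Fin n) → Fin n → Set
  PathFrom u []       last = u ≡ last
  PathFrom u (v ∷ vs) last = Adj u v × PathFrom v vs last

  Cycle : Set
  Cycle = Σ (Fin n) λ v0 → Σ (List (Fin n)) λ vs → Σ (Fin n) λ vm →
            (2 ≤ length vs) × Unique (v0 ∷ vs) × PathFrom v0 vs vm × Adj vm v0

  Acyclic : Set
  Acyclic = ¬ Cycle

  IsTree : Set
  IsTree = (1 ≤ n) × Connected × Acyclic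

  Dissociation : Subset n → Set
  Dissociation S = ∀ v → v ∈ S → ∣ S ∩ nbhd v ∣ ≤ 1

  MaxDissociation : Subset n → Set
  MaxDissociation S = Dissociation S × (∀ S′ → Dissociation S′ → ∣ S′ ∣ ≤ ∣ S ∣)

  Flexible : Fin n → Set
  Flexible v = (Σ (Subset n) λ S → MaxDissociation S × v ∈ S)
             × (Σ (Subset n) λ S → MaxDissociation S × v ∉ S)

deleteEdge : ∀ {n} → Graph n → Fin n → Fin n → Graph n
deleteEdge {n} G u v = record { adj = a ; sym = s ; irrefl = i }
  where
  open import Data.Fin using (_≟_)
  open import Relation.Nullary using (yes; no)
  open import Relation.Binary.PropositionalEquality using (refl; trans; sym)
  isE : Fin n → Fin n → Bool
  isE x y with x ≟ u | y ≟ v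
  ... | yes _ | yes _ = true
  ... | _     | _     = false
  a : Fin n → Fin n → Bool
  a x y with isE x y | isE y x
  ... | true  | _    = false
  ... | false | true = false
  ... | false | false = adj G x y
  s : ∀ x y → a x y ≡ a y x
  s x y with isE x y | isE y x
  ... | true  | true  = refl
  ... | true  | false = refl
  ... | false | true  = refl
  ... | false | false = Graph.sym G x y
  i : ∀ x → a x x ≡ false
  i x with isE x x
  ... | true  = refl
  ... | false = Graph.irrefl G x

module _ {n : ℕ} (G : Graph n) where

  -- e = uv is α₃-critical: it is an edge and α₃(G - e) > α₃(G)
  Critical : Fin n → Fin n → Set
  Critical u v = Adj G u v ×
    (Σ (Subset n) λ S → Dissociation (deleteEdge G u v) S ×
       (∀ S′ → Dissociation G S′ → ∣ S′ ∣ < ∣ S ∣))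

  Insulated : Fin n → Fin n → Set
  Insulated u v = Critical u v ×
    (∀ w → w ≢ v → ¬ Critical u w) × (∀ w → w ≢ u → ¬ Critical v w)

  -- critical 3-path a - c - b, recorded once by requiring toℕ a < toℕ b
  Critical3Path : Fin n × Fin n × Fin n → Set
  Critical3Path (a , c , b) = (toℕ a < toℕ b) × Critical c a × Critical c b

  -- insulated critical edge recorded once as (u , v) with toℕ u < toℕ v
  InsulatedEdge : Fin n × Fin n → Set
  InsulatedEdge (u , v) = (toℕ u < toℕ v) × Insulated u v

HasExactly : {A : Set} → (A → Set) → ℕ → Set
HasExactly {A} P m = Σ (List A) λ L → Unique L × (length L ≡ m) × (∀ a → (a LM.∈ L) ⇔ P a)

-- Let S be a maximum dissociation set of the tree T.  Exchanging S with a larger dissociation set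
-- of T − pq on one of the two components of T − pq shows: every critical edge has an end in S; on a
-- critical 3-path a–c–b, S ∩ {a, c, b} is {a, b}, {a, c} or {c, b}; an insulated critical edge has
-- exactly one end in S; and a vertex lying in some but not all maximum dissociation sets is an end
-- of a critical edge.  Since every critical edge lies on a critical 3-path or is insulated, a
-- maximum dissociation set is determined by one of three patterns on each critical 3-path and one
-- of two on each insulated edge, so there are at most 3^x · 2^y of them.
module Submission where

open import Defs hiding (sym)
open import Data.Bool using (Bool; true; false; _∧_; _∨_; not; if_then_else_) renaming (_≟_ to _≟ᵇ_)
open import Data.Bool.Properties using (¬-not; ∧-zeroʳ; ⇔→≡)
open import Data.Empty using (⊥; ⊥-elim)
open import Data.Fin using (Fin; zero; suc; _≟_; toℕ; combine; funToFin; finToFun)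
open import Data.Fin.Properties using (any?; pigeonhole; <⇒≢; toℕ-injective; combine-injective; finToFun-funToFin)
open import Data.Fin.Subset as Subset using (Subset; _∈_; ∣_∣)
open import Data.List using (List; []; _∷_; length; lookup; _∷ʳ_)
open import Data.List.Membership.Propositional using () renaming (_∈_ to _∈ᴸ_)
open import Data.List.Membership.Propositional.Properties using (∈-lookup)
open import Data.List.Relation.Binary.Subset.Propositional using () renaming (_⊆_ to _⊆ᴸ_)
open import Data.List.Relation.Unary.All as All using (All; []; _∷_)
open import Data.List.Relation.Unary.All.Properties using (anti-mono; ∷ʳ⁺; ¬Any⇒All¬)
open import Data.List.Relation.Unary.AllPairs using ([]; _∷_)
open import Data.List.Relation.Unary.Any as Any using (here; there)
open import Data.List.Relation.Unary.Any.Properties using (lookup-index)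
open import Data.List.Relation.Unary.Unique.Propositional using (Unique)
open import Data.Nat using (ℕ; zero; suc; _+_; _*_; _^_; _≤_; _<_; _≤′_; ≤′-refl; ≤′-step; _<?_; z≤n; s≤s)
open import Data.Nat.Properties
  using ( ≤-refl; ≤-reflexive; ≤-trans; ≤-<-trans; <-irrefl; <-cmp; <⇒≱; ≮⇒≥; n<1+n; n≤1+n; ≤⇒≤′
        ; +-comm; +-suc; +-identityʳ; +-mono-≤; +-monoˡ-≤; +-monoʳ-≤; +-monoˡ-<; +-cancelˡ-<; +-cancelʳ-<
        ; +-0-commutativeMonoid; module ≤-Reasoning)
open import Algebra.Properties.CommutativeMonoid.Sum +-0-commutativeMonoid
  using (sum; ∑-distrib-+; ∑-comm; sum-cong-≗; sum-replicate-zero)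
open import Data.Product using (∃; _×_; _,_; proj₁; proj₂)
open import Data.Sum using (_⊎_; inj₁; inj₂; [_,_])
open import Data.Vec as Vec using (tabulate; []; _∷_)
open import Data.Vec.Properties using (tabulate-cong; tabulate∘lookup; lookup∘tabulate; lookup-zipWith; []=⇒lookup; lookup⇒[]=)
open import Function using (id; _∘_)
open import Function.Bundles using (_⇔_; mk⇔; Equivalence)
open import Relation.Binary.Definitions using (tri<; tri≈; tri>)
open import Relation.Binary.PropositionalEquality hiding ([_])
open import Relation.Nullary using (¬_; Dec; yes; no; does; contradiction)
open import Relation.Nullary.Decidable using (_×-dec_; _⊎-dec_)

-- Sets of vertices are Boolean predicates on Fin n; a Subset n becomes one through Vec.lookup.

≡true⇒≢false : ∀ {b} → b ≡ true → b ≢ false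
≡true⇒≢false refl ()

∧-true⁻ : ∀ {a b} → a ∧ b ≡ true → a ≡ true × b ≡ true
∧-true⁻ {true} {true} refl = refl , refl

∧-true⁺ : ∀ {a b} → a ≡ true → b ≡ true → a ∧ b ≡ true
∧-true⁺ refl refl = refl

not-true : ∀ {b} → not b ≡ true → b ≡ false
not-true {false} refl = refl

not-false : ∀ {b} → b ≡ false → not b ≡ true
not-false refl = refl

_⊆_ : ∀ {n} → (Fin n → Bool) → (Fin n → Bool) → Set
A ⊆ B = ∀ x → A x ≡ true → B x ≡ true

_∩_ : ∀ {n} → (Fin n → Bool) → (Fin n → Bool) → Fin n → Bool
(A ∩ B) x = A x ∧ B x

∁ : ∀ {n} → (Fin n → Bool) → Fin n → Bool
∁ A x = not (A x)

⁅_⁆ : ∀ {n} → Fin n → Fin n → Bool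
⁅ v ⁆ x = does (x ≟ v)

glue : ∀ {n} → (Fin n → Bool) → (Fin n → Bool) → (Fin n → Bool) → Fin n → Bool
glue P A B x = if P x then A x else B x

⁅⁆-self : ∀ {n} (v : Fin n) → ⁅ v ⁆ v ≡ true
⁅⁆-self v with v ≟ v
... | yes _   = refl
... | no  v≢v = contradiction refl v≢v

∩-⊆ˡ : ∀ {n} (P A : Fin n → Bool) → (P ∩ A) ⊆ P
∩-⊆ˡ P A x PAx = proj₁ (∧-true⁻ PAx)

∩-⊆ʳ : ∀ {n} (P A : Fin n → Bool) → (P ∩ A) ⊆ A
∩-⊆ʳ P A x PAx = proj₂ (∧-true⁻ PAx)

glue-inside : ∀ {n} (P A B : Fin n → Bool) {x} → P x ≡ true → glue P A B x ≡ A x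
glue-inside P A B Px rewrite Px = refl

glue-outside : ∀ {n} (P A B : Fin n → Bool) {x} → P x ≡ false → glue P A B x ≡ B x
glue-outside P A B Px rewrite Px = refl

glue-∁ : ∀ {n} (P A B : Fin n → Bool) x → glue (∁ P) B A x ≡ glue P A B x
glue-∁ P A B x with P x
... | true  = refl
... | false = refl

∩-glue-⊆ : ∀ {n} (Q P A B : Fin n → Bool) → (Q ∩ glue P A B) ⊆ glue P (A ∩ Q) B
∩-glue-⊆ Q P A B x QGx with Q x | P x | A x | B x
... | true | true  | true | _    = refl
... | true | false | _    | true = refl

bit : Bool → ℕ
bit true  = 1
bit false = 0

count : ∀ {n} → (Fin n → Bool) → ℕ
count A = sum λ x → bit (A x)

sum-mono-≤ : ∀ {n} {f g : Fin n → ℕ} → (∀ x → f x ≤ g x) → sum f ≤ sum g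
sum-mono-≤ {zero}  f≤g = z≤n
sum-mono-≤ {suc n} f≤g = +-mono-≤ (f≤g zero) (sum-mono-≤ (λ x → f≤g (suc x)))

bit-mono : ∀ {a b} → (a ≡ true → b ≡ true) → bit a ≤ bit b
bit-mono {false} a⇒b = z≤n
bit-mono {true}  a⇒b rewrite a⇒b refl = ≤-refl

bit-≤ : ∀ {b m} → (b ≡ true → 1 ≤ m) → bit b ≤ m
bit-≤ {false} _   = z≤n
bit-≤ {true}  1≤m = 1≤m refl

≤-bit : ∀ {b m} → m ≤ 1 → (b ≡ false → m ≡ 0) → m ≤ bit b
≤-bit {true}  m≤1 _   = m≤1
≤-bit {false} _   m≡0 = ≤-reflexive (m≡0 refl)

count-mono : ∀ {n} {A B : Fin n → Bool} → A ⊆ B → count A ≤ count B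
count-mono A⊆B = sum-mono-≤ λ x → bit-mono (A⊆B x)

count-cong : ∀ {n} {A B : Fin n → Bool} → (∀ x → A x ≡ B x) → count A ≡ count B
count-cong A≗B = sum-cong-≗ λ x → cong bit (A≗B x)

count-pointwise : ∀ {n} {A B C D : Fin n → Bool} →
  (∀ x → bit (A x) + bit (B x) ≡ bit (C x) + bit (D x)) →
  count A + count B ≡ count C + count D
count-pointwise {A = A} {B} {C} {D} eq = begin
  count A + count B                  ≡⟨ ∑-distrib-+ (λ x → bit (A x)) (λ x → bit (B x)) ⟨
  sum (λ x → bit (A x) + bit (B x))  ≡⟨ sum-cong-≗ eq ⟩
  sum (λ x → bit (C x) + bit (D x))  ≡⟨ ∑-distrib-+ (λ x → bit (C x)) (λ x → bit (D x)) ⟩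
  count C + count D                  ∎
  where open ≡-Reasoning

count-empty : ∀ {n} {A : Fin n → Bool} → (∀ x → A x ≡ false) → count A ≡ 0
count-empty {n} A≡∅ = trans (sum-cong-≗ λ x → cong bit (A≡∅ x)) (sum-replicate-zero n)

count-⁅⁆ : ∀ {n} (v : Fin n) → count ⁅ v ⁆ ≡ 1
count-⁅⁆ {suc n} zero    = cong suc (count-empty {n} λ _ → refl)
count-⁅⁆ {suc n} (suc v) = count-⁅⁆ v

count≤1 : ∀ {n} {A : Fin n → Bool} (v : Fin n) → (∀ x → A x ≡ true → x ≡ v) → count A ≤ 1
count≤1 {A = A} v only-v = subst (count A ≤_) (count-⁅⁆ v) (count-mono A⊆⁅v⁆)
  where
  A⊆⁅v⁆ : A ⊆ ⁅ v ⁆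
  A⊆⁅v⁆ x Ax rewrite only-v x Ax = ⁅⁆-self v

count-pos : ∀ {n} {A : Fin n → Bool} {v : Fin n} → A v ≡ true → 1 ≤ count A
count-pos {A = A} {v} Av = subst (_≤ count A) (count-⁅⁆ v) (count-mono ⁅v⁆⊆A)
  where
  ⁅v⁆⊆A : ⁅ v ⁆ ⊆ A
  ⁅v⁆⊆A x x≡v with x ≟ v
  ... | yes refl = Av

count-pair : ∀ {n} {A : Fin n → Bool} {x y : Fin n} → x ≢ y → A x ≡ true → A y ≡ true → 2 ≤ count A
count-pair {A = A} {x} {y} x≢y Ax Ay = begin
  2                                          ≡⟨ cong₂ _+_ (count-⁅⁆ x) (count-⁅⁆ y) ⟨
  count ⁅ x ⁆ + count ⁅ y ⁆                  ≡⟨ ∑-distrib-+ (λ z → bit (⁅ x ⁆ z)) (λ z → bit (⁅ y ⁆ z)) ⟨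
  sum (λ z → bit (⁅ x ⁆ z) + bit (⁅ y ⁆ z))  ≤⟨ sum-mono-≤ pointwise ⟩
  count A                                    ∎
  where
  open ≤-Reasoning
  pointwise : ∀ z → bit (⁅ x ⁆ z) + bit (⁅ y ⁆ z) ≤ bit (A z)
  pointwise z with z ≟ x | z ≟ y
  ... | yes refl | yes refl = contradiction refl x≢y
  ... | yes refl | no _     rewrite Ax = ≤-refl
  ... | no _     | yes refl rewrite Ay = ≤-refl
  ... | no _     | no _     = z≤n

count≤1-unique : ∀ {n} (A : Fin n → Bool) {x y : Fin n} → count A ≤ 1 → A x ≡ true → A y ≡ true → x ≡ y
count≤1-unique A {x} {y} A≤1 Ax Ay with x ≟ y
... | yes x≡y = x≡y
... | no  x≢y = contradiction (≤-trans (count-pair x≢y Ax Ay) A≤1) λ { (s≤s ()) }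

unique-count≤1 : ∀ {n} {A : Fin n → Bool} → (∀ x y → A x ≡ true → A y ≡ true → x ≡ y) → count A ≤ 1
unique-count≤1 {A = A} unique with any? (λ x → A x ≟ᵇ true)
... | yes (v , Av) = count≤1 v λ x Ax → unique x v Ax Av
... | no  ∄v       = ≤-trans (≤-reflexive (count-empty λ x → ¬-not λ Ax → ∄v (x , Ax))) z≤n

count-remove : ∀ {n} (A : Fin n → Bool) {v : Fin n} → A v ≡ true → count A ≡ suc (count (A ∩ ∁ ⁅ v ⁆))
count-remove {n} A {v} Av = begin
  count A                             ≡⟨ +-identityʳ (count A) ⟨
  count A + 0                         ≡⟨ cong (count A +_) (count-empty {n} {λ _ → false} λ _ → refl) ⟨
  count A + count {n} (λ _ → false)   ≡⟨ count-pointwise pointwise ⟩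
  count (A ∩ ∁ ⁅ v ⁆) + count ⁅ v ⁆   ≡⟨ cong (count (A ∩ ∁ ⁅ v ⁆) +_) (count-⁅⁆ v) ⟩
  count (A ∩ ∁ ⁅ v ⁆) + 1             ≡⟨ +-comm _ 1 ⟩
  suc (count (A ∩ ∁ ⁅ v ⁆))           ∎
  where
  open ≡-Reasoning
  pointwise : ∀ x → bit (A x) + 0 ≡ bit ((A ∩ ∁ ⁅ v ⁆) x) + bit (⁅ v ⁆ x)
  pointwise x with x ≟ v
  ... | yes refl rewrite Av = refl
  ... | no  _ with A x
  ...   | true  = refl
  ...   | false = refl

count-glue-swap : ∀ {n} (P A B : Fin n → Bool) → count (glue P A B) + count (glue P B A) ≡ count A + count B
count-glue-swap P A B = count-pointwise pointwise
  where
  pointwise : ∀ x → bit (glue P A B x) + bit (glue P B A x) ≡ bit (A x) + bit (B x)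
  pointwise x with P x
  ... | true  = refl
  ... | false = +-comm (bit (B x)) (bit (A x))

count-glue : ∀ {n} (P A B : Fin n → Bool) → count (glue P A B) + count (P ∩ B) ≡ count (P ∩ A) + count B
count-glue P A B = count-pointwise pointwise
  where
  pointwise : ∀ x → bit (glue P A B x) + bit ((P ∩ B) x) ≡ bit ((P ∩ A) x) + bit (B x)
  pointwise x with P x
  ... | true  = refl
  ... | false = +-comm (bit (B x)) 0

glue-count-gain : ∀ {n} (P A B : Fin n → Bool) → count (P ∩ B) < count (P ∩ A) → count B < count (glue P A B)
glue-count-gain P A B gain = +-cancelʳ-< (count (P ∩ B)) (count B) (count (glue P A B)) (begin-strict
  count B + count (P ∩ B)             ≡⟨ +-comm (count B) _ ⟩
  count (P ∩ B) + count B             <⟨ +-monoˡ-< (count B) gain ⟩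
  count (P ∩ A) + count B             ≡⟨ count-glue P A B ⟨
  count (glue P A B) + count (P ∩ B)  ∎)
  where open ≤-Reasoning

glue-larger : ∀ {n} (P A B : Fin n → Bool) → count B < count A →
  count B < count (glue P A B) ⊎ count B < count (glue P B A)
glue-larger P A B B<A with count B <? count (glue P A B)
... | yes B<AB = inj₁ B<AB
... | no  B≮AB = inj₂ (+-cancelˡ-< (count (glue P A B)) _ _ (begin-strict
  count (glue P A B) + count B             ≤⟨ +-monoˡ-≤ (count B) (≮⇒≥ B≮AB) ⟩
  count B + count B                        <⟨ +-monoˡ-< (count B) B<A ⟩
  count A + count B                        ≡⟨ count-glue-swap P A B ⟨
  count (glue P A B) + count (glue P B A)  ∎))
  where open ≤-Reasoning

Unique-lookup-injective : ∀ {A : Set} {xs : List A} → Unique xs → ∀ i j → lookup xs i ≡ lookup xs j → i ≡ j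
Unique-lookup-injective (_ ∷ _)   zero    zero    _  = refl
Unique-lookup-injective (x∉ ∷ _)  zero    (suc j) eq = contradiction eq (All.lookup x∉ (∈-lookup j))
Unique-lookup-injective (x∉ ∷ _)  (suc i) zero    eq = contradiction (sym eq) (All.lookup x∉ (∈-lookup i))
Unique-lookup-injective (_ ∷ xs!) (suc i) (suc j) eq = cong suc (Unique-lookup-injective xs! i j eq)

length≤-injective : ∀ {A : Set} {N} (f : A → Fin N) {xs : List A} → Unique xs →
  (∀ {a b} → a ∈ᴸ xs → b ∈ᴸ xs → f a ≡ f b → a ≡ b) → length xs ≤ N
length≤-injective {N = N} f {xs} xs! f-inj with N <? length xs
... | no  N≮len = ≮⇒≥ N≮len
... | yes N<len with pigeonhole N<len (f ∘ lookup xs)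
...   | i , j , i<j , fi≡fj =
  contradiction (Unique-lookup-injective xs! i j (f-inj (∈-lookup i) (∈-lookup j) fi≡fj)) (<⇒≢ i<j)

adj-sym : ∀ {n} (G : Graph n) {x y : Fin n} → Adj G x y → Adj G y x
adj-sym G {x} {y} xy = trans (Graph.sym G y x) xy

adj-irrefl : ∀ {n} (G : Graph n) {x y : Fin n} → Adj G x y → x ≢ y
adj-irrefl G {x} xx refl = ≡true⇒≢false xx (Graph.irrefl G x)

SameEdge : ∀ {n} → Fin n → Fin n → Fin n → Fin n → Set
SameEdge x y u v = (x ≡ u × y ≡ v) ⊎ (x ≡ v × y ≡ u)

module _ {n} (G : Graph n) (u v : Fin n) where

  deleteEdge-⊆ : ∀ {x y} → Adj (deleteEdge G u v) x y → Adj G x y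
  deleteEdge-⊆ {x} {y} xy with x ≟ u | y ≟ v | y ≟ u | x ≟ v
  ... | yes _ | no _ | yes _ | no _ = xy
  ... | yes _ | no _ | no _  | _    = xy
  ... | no _  | _    | yes _ | no _ = xy
  ... | no _  | _    | no _  | _    = xy

  deleteEdge-removes : ¬ Adj (deleteEdge G u v) u v
  deleteEdge-removes with u ≟ u | v ≟ v
  ... | yes _   | yes _   = λ ()
  ... | no  u≢u | _       = contradiction refl u≢u
  ... | yes _   | no  v≢v = contradiction refl v≢v

  deleteEdge-avoids : ∀ {x y} → Adj (deleteEdge G u v) x y → ¬ SameEdge x y u v
  deleteEdge-avoids xy (inj₁ (refl , refl)) = deleteEdge-removes xy
  deleteEdge-avoids xy (inj₂ (refl , refl)) = deleteEdge-removes (adj-sym (deleteEdge G u v) {v} {u} xy)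

  deleteEdge-keeps : ∀ {x y} → Adj G x y → ¬ SameEdge x y u v → Adj (deleteEdge G u v) x y
  deleteEdge-keeps {x} {y} xy other with x ≟ u | y ≟ v | y ≟ u | x ≟ v
  ... | yes x≡u | yes y≡v | _       | _       = contradiction (inj₁ (x≡u , y≡v)) other
  ... | yes _   | no _    | yes y≡u | yes x≡v = contradiction (inj₂ (x≡v , y≡u)) other
  ... | yes _   | no _    | yes _   | no _    = xy
  ... | yes _   | no _    | no _    | _       = xy
  ... | no _    | _       | yes y≡u | yes x≡v = contradiction (inj₂ (x≡v , y≡u)) other
  ... | no _    | _       | yes _   | no _    = xy
  ... | no _    | _       | no _    | _       = xy

deleteEdge-swap : ∀ {n} (G : Graph n) (u v x y : Fin n) → Adj (deleteEdge G u v) x y → Adj (deleteEdge G v u) x y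
deleteEdge-swap G u v x y xy = deleteEdge-keeps G v u (deleteEdge-⊆ G u v xy) (deleteEdge-avoids G u v xy ∘ flip)
  where
  flip : SameEdge x y v u → SameEdge x y u v
  flip (inj₁ e) = inj₂ e
  flip (inj₂ e) = inj₁ e

Critical-sym : ∀ {n} (G : Graph n) {p q : Fin n} → Critical G p q → Critical G q p
Critical-sym G {p} {q} (pq , S , S-diss , S-large) = adj-sym G pq , S , S-diss′ , S-large
  where
  same-nbhd : ∀ x → nbhd (deleteEdge G p q) x ≡ nbhd (deleteEdge G q p) x
  same-nbhd x = tabulate-cong λ y → ⇔→≡ (mk⇔ (deleteEdge-swap G p q x y) (deleteEdge-swap G q p x y))
  S-diss′ : Dissociation (deleteEdge G q p) S
  S-diss′ x x∈S = subst (λ N → ∣ S Subset.∩ N ∣ ≤ 1) (same-nbhd x) (S-diss x x∈S)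

module _ {n} (G : Graph n) where

  degreeIn : (Fin n → Bool) → Fin n → ℕ
  degreeIn A x = count (A ∩ adj G x)

  IsDissociation : (Fin n → Bool) → Set
  IsDissociation A = ∀ x → A x ≡ true → degreeIn A x ≤ 1

  IsMaximumDissociation : (Fin n → Bool) → Set
  IsMaximumDissociation A = IsDissociation A × (∀ B → IsDissociation B → count B ≤ count A)

IsDissociation-⊆ : ∀ {n} (G : Graph n) {A B : Fin n → Bool} → A ⊆ B → IsDissociation G B → IsDissociation G A
IsDissociation-⊆ G {A} {B} A⊆B B-diss x Ax = ≤-trans (count-mono nbrs⊆) (B-diss x (A⊆B x Ax))
  where
  nbrs⊆ : (A ∩ adj G x) ⊆ (B ∩ adj G x)
  nbrs⊆ y Axy = let (Ay , xy) = ∧-true⁻ Axy in ∧-true⁺ (A⊆B y Ay) xy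

IsDissociation-∩ : ∀ {n} (G : Graph n) P {A} → IsDissociation G A → IsDissociation G (P ∩ A)
IsDissociation-∩ G P {A} = IsDissociation-⊆ G (∩-⊆ʳ P A)

IsDissociation-neighbour-unique : ∀ {n} (G : Graph n) {A : Fin n → Bool} {x y z : Fin n} → IsDissociation G A →
  A x ≡ true → A y ≡ true → Adj G x y → A z ≡ true → Adj G x z → y ≡ z
IsDissociation-neighbour-unique G {A} {x} {y} {z} A-diss Ax Ay xy Az xz =
  count≤1-unique (A ∩ adj G x) {y} {z} (A-diss x Ax) (∧-true⁺ Ay xy) (∧-true⁺ Az xz)

IsDissociation-subgraph : ∀ {n} (G H : Graph n) {A : Fin n → Bool} → (∀ {x y} → Adj H x y → Adj G x y) →
  IsDissociation G A → IsDissociation H A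
IsDissociation-subgraph G H {A} H⊆G A-diss x Ax = ≤-trans (count-mono nbrs⊆) (A-diss x Ax)
  where
  nbrs⊆ : (A ∩ adj H x) ⊆ (A ∩ adj G x)
  nbrs⊆ y Axy = let (Ay , xy) = ∧-true⁻ Axy in ∧-true⁺ Ay (H⊆G xy)

IsDissociation-deleteEdge⁺ : ∀ {n} (G : Graph n) (u v : Fin n) {A : Fin n → Bool} →
  IsDissociation G A → IsDissociation (deleteEdge G u v) A
IsDissociation-deleteEdge⁺ G u v = IsDissociation-subgraph G (deleteEdge G u v) (deleteEdge-⊆ G u v)

IsDissociation-deleteEdge-comm : ∀ {n} (G : Graph n) (u v : Fin n) {A : Fin n → Bool} →
  IsDissociation (deleteEdge G u v) A → IsDissociation (deleteEdge G v u) A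
IsDissociation-deleteEdge-comm G u v =
  IsDissociation-subgraph (deleteEdge G u v) (deleteEdge G v u) (λ {x} {y} → deleteEdge-swap G v u x y)

IsDissociation-deleteEdge⁻ : ∀ {n} (G : Graph n) {u v : Fin n} {A : Fin n → Bool} →
  ¬ (A u ≡ true × A v ≡ true) → IsDissociation (deleteEdge G u v) A → IsDissociation G A
IsDissociation-deleteEdge⁻ G {u} {v} {A} ¬uv∈A A-diss x Ax = ≤-trans (count-mono nbrs⊆) (A-diss x Ax)
  where
  other : ∀ {y} → A y ≡ true → ¬ SameEdge x y u v
  other Ay (inj₁ (refl , refl)) = ¬uv∈A (Ax , Ay)
  other Ay (inj₂ (refl , refl)) = ¬uv∈A (Ay , Ax)
  nbrs⊆ : (A ∩ adj G x) ⊆ (A ∩ adj (deleteEdge G u v) x)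
  nbrs⊆ y Axy = let (Ay , xy) = ∧-true⁻ Axy in ∧-true⁺ Ay (deleteEdge-keeps G u v xy (other Ay))

IsDissociation-∩-deleteEdge : ∀ {n} (G : Graph n) P {A u v} → P u ≡ false ⊎ P v ≡ false →
  IsDissociation (deleteEdge G u v) A → IsDissociation G (P ∩ A)
IsDissociation-∩-deleteEdge G P {A} {u} {v} uv∉P A-diss =
  IsDissociation-deleteEdge⁻ G ¬uv∈P∩A (IsDissociation-∩ (deleteEdge G u v) P A-diss)
  where
  ¬uv∈P∩A : ¬ ((P ∩ A) u ≡ true × (P ∩ A) v ≡ true)
  ¬uv∈P∩A (PAu , PAv) = [ ≡true⇒≢false (∩-⊆ˡ P A u PAu) , ≡true⇒≢false (∩-⊆ˡ P A v PAv) ] uv∉P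

∣∣≡count : ∀ {n} (S : Subset n) → ∣ S ∣ ≡ count (Vec.lookup S)
∣∣≡count []          = refl
∣∣≡count (true ∷ S)  = cong suc (∣∣≡count S)
∣∣≡count (false ∷ S) = ∣∣≡count S

∣tabulate∣≡count : ∀ {n} (A : Fin n → Bool) → ∣ tabulate A ∣ ≡ count A
∣tabulate∣≡count A = trans (∣∣≡count (tabulate A)) (count-cong (lookup∘tabulate A))

module _ {n} (G : Graph n) where

  ∣∩nbhd∣≡degreeIn : ∀ S x → ∣ S Subset.∩ nbhd G x ∣ ≡ degreeIn G (Vec.lookup S) x
  ∣∩nbhd∣≡degreeIn S x = trans (∣∣≡count (S Subset.∩ nbhd G x)) (count-cong λ y →
    trans (lookup-zipWith _∧_ y S (tabulate (adj G x))) (cong (Vec.lookup S y ∧_) (lookup∘tabulate (adj G x) y)))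

  dissociation-lookup : ∀ {S} → Dissociation G S → IsDissociation G (Vec.lookup S)
  dissociation-lookup {S} S-diss x Sx = subst (_≤ 1) (∣∩nbhd∣≡degreeIn S x) (S-diss x (lookup⇒[]= x S Sx))

  dissociation-tabulate : ∀ {A} → IsDissociation G A → Dissociation G (tabulate A)
  dissociation-tabulate {A} A-diss x x∈A = subst (_≤ 1) (sym degree) (A-diss x (trans (sym (lookup∘tabulate A x)) ([]=⇒lookup x∈A)))
    where
    degree : ∣ tabulate A Subset.∩ nbhd G x ∣ ≡ degreeIn G A x
    degree = trans (∣∩nbhd∣≡degreeIn (tabulate A) x) (count-cong λ y → cong (_∧ adj G x y) (lookup∘tabulate A y))

  maxDissociation-lookup : ∀ {S} → MaxDissociation G S → IsMaximumDissociation G (Vec.lookup S)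
  maxDissociation-lookup {S} (S-diss , S-max) = dissociation-lookup S-diss , λ B B-diss →
    subst₂ _≤_ (∣tabulate∣≡count B) (∣∣≡count S) (S-max (tabulate B) (dissociation-tabulate B-diss))

module _ {n} (G : Graph n) where

  critical⇒larger : ∀ {p q S} → Critical G p q → IsMaximumDissociation G S →
    ∃ λ A → IsDissociation (deleteEdge G p q) A × count S < count A
  critical⇒larger {p} {q} {S} (_ , A , A-diss , A-large) (S-diss , _) =
    Vec.lookup A , dissociation-lookup (deleteEdge G p q) A-diss ,
    subst₂ _<_ (∣tabulate∣≡count S) (∣∣≡count A) (A-large (tabulate S) (dissociation-tabulate G S-diss))

  larger⇒critical : ∀ {p q S A} → Adj G p q → IsDissociation (deleteEdge G p q) A → IsMaximumDissociation G S →
    count S < count A → Critical G p q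
  larger⇒critical {p} {q} {S} {A} pq A-diss (_ , S-max) S<A =
    pq , tabulate A , dissociation-tabulate (deleteEdge G p q) A-diss , λ B B-diss → begin-strict
      ∣ B ∣                 ≡⟨ ∣∣≡count B ⟩
      count (Vec.lookup B)  ≤⟨ S-max (Vec.lookup B) (dissociation-lookup G B-diss) ⟩
      count S               <⟨ S<A ⟩
      count A               ≡⟨ ∣tabulate∣≡count A ⟨
      ∣ tabulate A ∣        ∎
    where open ≤-Reasoning

-- Gluing two dissociation sets along a cut crossed by a single edge

SingleCrossing : ∀ {n} → Graph n → (Fin n → Bool) → Fin n → Fin n → Set
SingleCrossing G P p q = ∀ x y → P x ≡ true → P y ≡ false → Adj G x y → x ≡ p × y ≡ q

module _ {n} (G : Graph n) where

  SingleCrossing-∁ : ∀ {P p q} → SingleCrossing G P p q → SingleCrossing G (∁ P) q p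
  SingleCrossing-∁ cross x y ∁Px ∁Py xy =
    let (y≡p , x≡q) = cross y x (not-false′ ∁Py) (not-true ∁Px) (adj-sym G xy) in x≡q , y≡p
    where
    not-false′ : ∀ {b} → not b ≡ false → b ≡ true
    not-false′ {true} refl = refl

  SingleCrossing-deleteEdge : ∀ u v {P p q} → SingleCrossing G P p q → SingleCrossing (deleteEdge G u v) P p q
  SingleCrossing-deleteEdge u v cross x y Px Py xy = cross x y Px Py (deleteEdge-⊆ G u v xy)

  glue-degree : ∀ {P A B p q} → SingleCrossing G P p q → IsDissociation G (P ∩ A) →
    (Adj G p q → A p ≡ true → B q ≡ true → ∀ y → (P ∩ A) y ≡ true → ¬ Adj G p y) →
    ∀ x → P x ≡ true → A x ≡ true → degreeIn G (glue P A B) x ≤ 1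
  -- A glued neighbour of x outside P forces x = p and makes q the only glued neighbour of p.
  glue-degree {P} {A} {B} {p} {q} cross PA-diss lonely x Px Ax
    with any? (λ y → ((∁ P ∩ glue P A B) ∩ adj G x) y ≟ᵇ true)
  ... | no ∄outer = ≤-trans (count-mono inner) (PA-diss x (∧-true⁺ Px Ax))
    where
    inner : (glue P A B ∩ adj G x) ⊆ ((P ∩ A) ∩ adj G x)
    inner z Gxz with ∧-true⁻ {glue P A B z} Gxz | P z in Pz
    ... | Gz , xz | true  = ∧-true⁺ (trans (sym (glue-inside P A B Pz)) Gz) xz
    ... | Gz , xz | false = contradiction (z , ∧-true⁺ (∧-true⁺ (not-false Pz) Gz) xz) ∄outer
  ... | yes (y , outer) with ∧-true⁻ {(∁ P ∩ glue P A B) y} outer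
  ...   | ∁PGy , xy with ∧-true⁻ {not (P y)} ∁PGy
  ...     | ∁Py , Gy with cross x y Px (not-true ∁Py) xy
  ...       | refl , refl = count≤1 q only-q
    where
    Bq : B q ≡ true
    Bq = trans (sym (glue-outside P A B (not-true ∁Py))) Gy
    only-q : ∀ z → (glue P A B ∩ adj G p) z ≡ true → z ≡ q
    only-q z Gpz with ∧-true⁻ {glue P A B z} Gpz | P z in Pz
    ... | Gz , pz | false = proj₂ (cross p z Px Pz pz)
    ... | Gz , pz | true  = ⊥-elim (lonely xy Ax Bq z (∧-true⁺ Pz (trans (sym (glue-inside P A B Pz)) Gz)) pz)

  glue-isDissociation : ∀ {P A B p q} → SingleCrossing G P p q →
    IsDissociation G (P ∩ A) → IsDissociation G (∁ P ∩ B) →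
    (Adj G p q → A p ≡ true → B q ≡ true →
       (∀ y → (P ∩ A) y ≡ true → ¬ Adj G p y) × (∀ y → (∁ P ∩ B) y ≡ true → ¬ Adj G q y)) →
    IsDissociation G (glue P A B)
  glue-isDissociation {P} {A} {B} cross PA-diss ∁PB-diss lonely x glued with P x in Px
  ... | true  = glue-degree cross PA-diss (λ pq Ap Bq → proj₁ (lonely pq Ap Bq)) x Px glued
  ... | false = subst (_≤ 1) (count-cong λ y → cong (_∧ adj G x y) (glue-∁ P A B y))
                  (glue-degree (SingleCrossing-∁ cross) ∁PB-diss
                    (λ qp Bq Ap → proj₂ (lonely (adj-sym G qp) Ap Bq)) x (not-false Px) glued)

  glue-isDissociation-blocked : ∀ {P A B p q} → SingleCrossing G P p q →
    IsDissociation G (P ∩ A) → IsDissociation G (∁ P ∩ B) →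
    ¬ Adj G p q ⊎ A p ≡ false ⊎ B q ≡ false → IsDissociation G (glue P A B)
  glue-isDissociation-blocked cross PA-diss ∁PB-diss blocked =
    glue-isDissociation cross PA-diss ∁PB-diss λ pq Ap Bq → contradiction (pq , Ap , Bq) (unblocked blocked)
    where
    unblocked : ∀ {a b c} → ¬ a ≡ true ⊎ b ≡ false ⊎ c ≡ false → ¬ (a ≡ true × b ≡ true × c ≡ true)
    unblocked (inj₁ ¬a)        (a , _ , _) = ¬a a
    unblocked (inj₂ (inj₁ b₀)) (_ , b , _) = ≡true⇒≢false b b₀
    unblocked (inj₂ (inj₂ c₀)) (_ , _ , c) = ≡true⇒≢false c c₀

-- Reachability avoiding a vertex

module _ {n} (G : Graph n) where

  reachAvoiding : Fin n → Fin n → ℕ → Fin n → Bool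
  reachAvoiding p q zero    y = ⁅ p ⁆ y
  reachAvoiding p q (suc k) y = reachAvoiding p q k y ∨
    (not (⁅ q ⁆ y) ∧ does (any? λ x → (reachAvoiding p q k x ∧ adj G x y) ≟ᵇ true))

  -- The vertices reachable from p by a path avoiding q (simple paths are shorter than n); for an
  -- edge pq of a tree this is the component of p in T − pq.
  component : Fin n → Fin n → Fin n → Bool
  component p q = reachAvoiding p q n

  path-snoc : ∀ {u vs x y} → PathFrom G u vs x → Adj G x y → PathFrom G u (vs ∷ʳ y) y
  path-snoc {vs = []}    refl        xy = xy , refl
  path-snoc {vs = _ ∷ _} (uv , path) xy = uv , path-snoc path xy

  path-suffix : ∀ {u vs y w} → PathFrom G u vs y → Unique (u ∷ vs) → w ∈ᴸ (u ∷ vs) →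
    ∃ λ ws → PathFrom G w ws y × Unique (w ∷ ws) × ws ⊆ᴸ vs
  path-suffix path u! (here refl) = _ , path , u! , id
  path-suffix {vs = _ ∷ _} (_ , path) (_ ∷ v!) (there w∈) =
    let (ws , path′ , w! , ws⊆) = path-suffix path v! w∈ in ws , path′ , w! , there ∘ ws⊆

  simple-path : ∀ {u vs y} → PathFrom G u vs y → ∃ λ ws → PathFrom G u ws y × Unique (u ∷ ws) × ws ⊆ᴸ vs
  simple-path {vs = []} path = [] , path , [] ∷ [] , id
  simple-path {u} {v ∷ vs} (uv , path) with simple-path path
  ... | ws , path′ , v! , ws⊆ with Any.any? (u ≟_) (v ∷ ws)
  ...   | yes u∈ = let (ws′ , path″ , u! , ws′⊆) = path-suffix path′ v! u∈ in
    ws′ , path″ , u! , there ∘ ws⊆ ∘ ws′⊆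
  ...   | no  u∉ =
    v ∷ ws , (uv , path′) , ¬Any⇒All¬ _ u∉ ∷ v! , λ { (here refl) → here refl ; (there m) → there (ws⊆ m) }

  path-last : ∀ {u vs y q} → PathFrom G u vs y → All (_≢ q) (u ∷ vs) → y ≢ q
  path-last {vs = []}    refl     (u≢q ∷ _)     = u≢q
  path-last {vs = _ ∷ _} (_ , path) (_ ∷ avoid) = path-last path avoid

  reachAvoiding-sound : ∀ {p q} k {y} → p ≢ q → reachAvoiding p q k y ≡ true →
    ∃ λ vs → PathFrom G p vs y × All (_≢ q) (p ∷ vs)
  reachAvoiding-sound {p} zero {y} p≢q r with y ≟ p
  ... | yes refl = [] , refl , p≢q ∷ []
  reachAvoiding-sound {p} {q} (suc k) {y} p≢q r with reachAvoiding p q k y in old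
  ... | true = reachAvoiding-sound k p≢q old
  ... | false with y ≟ q | any? (λ x → (reachAvoiding p q k x ∧ adj G x y) ≟ᵇ true)
  ...   | no y≢q | yes (x , rx) =
    let (rx′ , xy) = ∧-true⁻ rx
        (vs , path , avoid) = reachAvoiding-sound k p≢q rx′
    in vs ∷ʳ y , path-snoc path xy , ∷ʳ⁺ avoid y≢q

  reachAvoiding-mono : ∀ {p q k m y} → k ≤′ m → reachAvoiding p q k y ≡ true → reachAvoiding p q m y ≡ true
  reachAvoiding-mono ≤′-refl         r = r
  reachAvoiding-mono (≤′-step k≤′m) r rewrite reachAvoiding-mono k≤′m r = refl

  reachAvoiding-complete : ∀ {p q x y} k vs → reachAvoiding p q k x ≡ true → PathFrom G x vs y → All (_≢ q) vs →
    reachAvoiding p q (k + length vs) y ≡ true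
  reachAvoiding-complete k [] r refl [] = subst (λ m → reachAvoiding _ _ m _ ≡ true) (sym (+-identityʳ k)) r
  reachAvoiding-complete {p} {q} {x} {y} k (w ∷ vs) r (xw , path) (w≢q ∷ avoid) =
    subst (λ m → reachAvoiding p q m y ≡ true) (sym (+-suc k (length vs)))
      (reachAvoiding-complete (suc k) vs reaches-w path avoid)
    where
    reaches-w : reachAvoiding p q (suc k) w ≡ true
    reaches-w with reachAvoiding p q k w | w ≟ q | any? (λ z → (reachAvoiding p q k z ∧ adj G z w) ≟ᵇ true)
    ... | true  | _       | _     = refl
    ... | false | yes w≡q | _     = contradiction w≡q w≢q
    ... | false | no _    | yes _ = refl
    ... | false | no _    | no ∄  = contradiction (x , ∧-true⁺ r xw) ∄

  component-source : ∀ p q → component p q p ≡ true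
  component-source p q = reachAvoiding-mono {p} {q} {m = n} {y = p} (≤⇒≤′ z≤n) (⁅⁆-self p)

  component-sound : ∀ {p q y} → p ≢ q → component p q y ≡ true →
    ∃ λ vs → PathFrom G p vs y × All (_≢ q) (p ∷ vs)
  component-sound = reachAvoiding-sound n

  component-complete : ∀ {p q vs y} → PathFrom G p vs y → All (_≢ q) (p ∷ vs) → component p q y ≡ true
  component-complete {p} {q} {y = y} path (_ ∷ avoid) with simple-path path
  ... | ws , path′ , p∷ws! , ws⊆ = reachAvoiding-mono {p} {q} {m = n} {y = y} (≤⇒≤′ short)
    (reachAvoiding-complete 0 ws (⁅⁆-self p) path′ (anti-mono ws⊆ avoid))
    where
    short : length ws ≤ n
    short = ≤-trans (n≤1+n _) (length≤-injective id p∷ws! λ _ _ eq → eq)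

  component-avoids : ∀ {p q} → p ≢ q → component p q q ≡ false
  component-avoids {p} {q} p≢q with component p q q in pq
  ... | false = refl
  ... | true  = let (vs , path , avoid) = component-sound p≢q pq in contradiction refl (path-last path avoid)

  component-extend : ∀ {p q x y} → p ≢ q → component p q x ≡ true → Adj G x y → y ≢ q → component p q y ≡ true
  component-extend p≢q px xy y≢q =
    let (vs , path , avoid) = component-sound p≢q px in component-complete (path-snoc path xy) (∷ʳ⁺ avoid y≢q)

  path-end-∈ : ∀ {u vs y} → PathFrom G u vs y → u ≢ y → y ∈ᴸ vs
  path-end-∈ {vs = []}            refl       u≢y = contradiction refl u≢y
  path-end-∈ {vs = v ∷ _} {y} (_ , path) u≢y with v ≟ y
  ... | yes refl = here refl
  ... | no  v≢y  = there (path-end-∈ path v≢y)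

  component-crossing : Acyclic G → ∀ {p q} → Adj G p q → SingleCrossing G (component p q) p q
  component-crossing acyclic {p} {q} pq x y px py xy = x≡p , y≡q
    where
    p≢q = adj-irrefl G pq
    y≡q : y ≡ q
    y≡q with y ≟ q
    ... | yes y≡q = y≡q
    ... | no  y≢q = ⊥-elim (≡true⇒≢false (component-extend p≢q px xy y≢q) py)
    cycle-through-q : x ≢ p → Cycle G
    cycle-through-q x≢p with component-sound p≢q px
    ... | vs , path , _ ∷ avoid with simple-path path
    ...   | ws , path′ , p∷ws! , ws⊆ =
      q , p ∷ ws , x , s≤s (nonempty (path-end-∈ path′ (x≢p ∘ sym))) , q∉ ∷ p∷ws! ,
      (adj-sym G pq , path′) , subst (Adj G x) y≡q xy
      where
      q∉ = All.map (_∘ sym) (p≢q ∷ anti-mono ws⊆ avoid)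
      nonempty : ∀ {zs : List (Fin n)} → x ∈ᴸ zs → 1 ≤ length zs
      nonempty (here _)  = s≤s z≤n
      nonempty (there _) = s≤s z≤n
    x≡p : x ≡ p
    x≡p with x ≟ p
    ... | yes x≡p = x≡p
    ... | no  x≢p = contradiction (cycle-through-q x≢p) acyclic

  path-stays : ∀ {R e f s vs y} → SingleCrossing G R e f → R s ≡ true →
    PathFrom G s vs y → All (_≢ e) (s ∷ vs) → R y ≡ true
  path-stays {vs = []} cross Rs refl _ = Rs
  path-stays {R} {vs = w ∷ _} cross Rs (sw , path) (s≢e ∷ avoid) with R w in Rw
  ... | true  = path-stays cross Rw path avoid
  ... | false = contradiction (proj₁ (cross _ w Rs Rw sw)) s≢e

  component-⊆ : ∀ {P p q w} → SingleCrossing G P p q → P w ≡ true → Adj G p w → component w p ⊆ P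
  component-⊆ cross Pw pw x wx =
    let (vs , path , avoid) = component-sound (adj-irrefl G (adj-sym G pw)) wx in path-stays cross Pw path avoid

  components-disjoint : Acyclic G → ∀ {a b c} → Adj G c a → Adj G c b → a ≢ b →
    ∀ x → component b c x ≡ true → component a c x ≡ false
  components-disjoint acyclic {a} {b} {c} ca cb a≢b x bx =
    let (vs , path , avoid) = component-sound (adj-irrefl G (adj-sym G cb)) bx
    in not-true (path-stays {vs = vs} (SingleCrossing-∁ G cross) b∉ path avoid)
    where
    cross = component-crossing acyclic (adj-sym G ca)
    b∉ : ∁ (component a c) b ≡ true
    b∉ with component a c b in ab
    ... | false = refl
    ... | true  = contradiction (sym (proj₁ (cross b c ab c∉ (adj-sym G cb)))) a≢b
      where c∉ = component-avoids (adj-irrefl G (adj-sym G ca))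

  component-cover : ∀ {x v} → Walk G x v → x ≢ v → ∃ λ w → Adj G v w × component w v x ≡ true
  component-cover here x≢v = contradiction refl x≢v
  component-cover {x} {v} (step {v = y} xy walk) x≢v with y ≟ v
  ... | yes refl = x , adj-sym G xy , component-source x v
  ... | no  y≢v  = let (w , vw , wy) = component-cover walk y≢v in
    w , vw , component-extend (adj-irrefl G (adj-sym G vw)) wy (adj-sym G xy) x≢v


-- Maximum dissociation sets of a tree

module _ {n} (T : Graph n) (acyclic : Acyclic T) where

  private
    crossing : ∀ {p q} → Adj T p q → SingleCrossing T (component T p q) p q
    crossing = component-crossing T acyclic

    source-outside : ∀ p q → ∁ (component T p q) p ≡ false
    source-outside p q = cong not (component-source T p q)

    target-outside : ∀ {p q} → Adj T p q → component T p q q ≡ false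
    target-outside pq = component-avoids T (adj-irrefl T pq)

  glue-component-isDissociation : ∀ {p q S A} → Adj T p q → IsDissociation T S → IsDissociation (deleteEdge T p q) A →
    S p ≡ false → IsDissociation T (glue (component T p q) S A)
  glue-component-isDissociation {p} {q} pq S-diss A-diss Sp = glue-isDissociation-blocked T (crossing pq)
    (IsDissociation-∩ T (component T p q) S-diss)
    (IsDissociation-∩-deleteEdge T (∁ (component T p q)) (inj₁ (source-outside p q)) A-diss)
    (inj₂ (inj₁ Sp))

  -- Exchanging S and the larger dissociation set A of T − pq on the component of p gives two
  -- dissociation sets of T with |A| + |S| > 2 |S| vertices in total.
  critical-edge-covered : ∀ {p q S} → Critical T p q → IsMaximumDissociation T S → S p ≡ false → S q ≡ false → ⊥
  critical-edge-covered {p} {q} {S} crit (S-diss , S-max) Sp Sq = <-irrefl refl (begin-strict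
    count A + count S                        ≡⟨ count-glue-swap P A S ⟨
    count (glue P A S) + count (glue P S A)  ≤⟨ +-mono-≤ (S-max _ A-on-P) (S-max _ S-on-P) ⟩
    count S + count S                        <⟨ +-monoˡ-< (count S) S<A ⟩
    count A + count S                        ∎)
    where
    open ≤-Reasoning
    pq = proj₁ crit
    P = component T p q
    larger = critical⇒larger T crit (S-diss , S-max)
    A = proj₁ larger
    S<A = proj₂ (proj₂ larger)
    A-on-P : IsDissociation T (glue P A S)
    A-on-P = glue-isDissociation-blocked T (crossing pq)
      (IsDissociation-∩-deleteEdge T P (inj₂ (target-outside pq)) (proj₁ (proj₂ larger)))
      (IsDissociation-∩ T (∁ P) S-diss) (inj₂ (inj₂ Sq))
    S-on-P : IsDissociation T (glue P S A)
    S-on-P = glue-component-isDissociation pq S-diss (proj₁ (proj₂ larger)) Sp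

  critical-component-gain : ∀ {p q S} → Critical T p q → IsMaximumDissociation T S → S p ≡ false →
    ∃ λ A → IsDissociation (deleteEdge T p q) A × count (component T p q ∩ S) < count (component T p q ∩ A)
  critical-component-gain {p} {q} {S} crit (S-diss , S-max) Sp =
    A , A-diss , +-cancelʳ-< (count A) _ _ (begin-strict
      count (P ∩ S) + count A             ≡⟨ count-glue P S A ⟨
      count (glue P S A) + count (P ∩ A)  <⟨ +-monoˡ-< (count (P ∩ A)) (≤-<-trans (S-max _ S-on-P) S<A) ⟩
      count A + count (P ∩ A)             ≡⟨ +-comm (count A) _ ⟩
      count (P ∩ A) + count A             ∎)
    where
    open ≤-Reasoning
    P = component T p q
    larger = critical⇒larger T crit (S-diss , S-max)
    A = proj₁ larger
    A-diss = proj₁ (proj₂ larger)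
    S<A = proj₂ (proj₂ larger)
    S-on-P = glue-component-isDissociation (proj₁ crit) S-diss A-diss Sp

  -- Replacing S by the larger dissociation sets of T − ca and T − cb on the components of a and b
  -- gains a vertex each time, while dropping c loses only one.
  critical-path-centre : ∀ {a c b S} → Critical T c a → Critical T c b → a ≢ b → IsMaximumDissociation T S →
    S c ≡ true → S a ≡ false → S b ≡ false → ⊥
  critical-path-centre {a} {c} {b} {S} ca cb a≢b (S-diss , S-max) Sc Sa Sb = <-irrefl refl (begin-strict
    count S         ≡⟨ count-remove S Sc ⟩
    suc (count S⁻)  ≤⟨ glue-count-gain Pb Ab S⁻ (≤-<-trans (count-mono Pb∩S⁻⊆) gain-b) ⟩
    count Sᵇ        <⟨ glue-count-gain Pa Aa Sᵇ (≤-<-trans (count-mono Pa∩Sᵇ⊆) gain-a) ⟩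
    count Sᵃᵇ       ≤⟨ S-max Sᵃᵇ Sᵃᵇ-diss ⟩
    count S         ∎)
    where
    open ≤-Reasoning
    ac = proj₁ (Critical-sym T ca)
    bc = proj₁ (Critical-sym T cb)
    Pa = component T a c
    Pb = component T b c
    ga = critical-component-gain (Critical-sym T ca) (S-diss , S-max) Sa
    gb = critical-component-gain (Critical-sym T cb) (S-diss , S-max) Sb
    Aa = proj₁ ga
    Ab = proj₁ gb
    gain-a = proj₂ (proj₂ ga)
    gain-b = proj₂ (proj₂ gb)
    S⁻ = S ∩ ∁ ⁅ c ⁆
    Sᵇ = glue Pb Ab S⁻
    Sᵃᵇ = glue Pa Aa Sᵇ
    S⁻c : S⁻ c ≡ false
    S⁻c rewrite ⁅⁆-self c = ∧-zeroʳ (S c)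
    Sᵇc : Sᵇ c ≡ false
    Sᵇc = trans (glue-outside Pb Ab S⁻ (target-outside bc)) S⁻c
    Sᵇ-diss : IsDissociation T Sᵇ
    Sᵇ-diss = glue-isDissociation-blocked T (crossing bc)
      (IsDissociation-∩-deleteEdge T Pb (inj₂ (target-outside bc)) (proj₁ (proj₂ gb)))
      (IsDissociation-∩ T (∁ Pb) (IsDissociation-⊆ T (∩-⊆ˡ S (∁ ⁅ c ⁆)) S-diss)) (inj₂ (inj₂ S⁻c))
    Sᵃᵇ-diss : IsDissociation T Sᵃᵇ
    Sᵃᵇ-diss = glue-isDissociation-blocked T (crossing ac)
      (IsDissociation-∩-deleteEdge T Pa (inj₂ (target-outside ac)) (proj₁ (proj₂ ga)))
      (IsDissociation-∩ T (∁ Pa) Sᵇ-diss) (inj₂ (inj₂ Sᵇc))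
    Pb∩S⁻⊆ : (Pb ∩ S⁻) ⊆ (Pb ∩ S)
    Pb∩S⁻⊆ x PbS⁻x = let (Pbx , S⁻x) = ∧-true⁻ PbS⁻x in ∧-true⁺ Pbx (∩-⊆ˡ S (∁ ⁅ c ⁆) x S⁻x)
    Pa∩Sᵇ⊆ : (Pa ∩ Sᵇ) ⊆ (Pa ∩ S)
    Pa∩Sᵇ⊆ x PaSᵇx = let (Pax , Sᵇx) = ∧-true⁻ PaSᵇx in
      ∧-true⁺ Pax (∩-⊆ˡ S (∁ ⁅ c ⁆) x (trans (sym (glue-outside Pb Ab S⁻ (Pb-disjoint x Pax))) Sᵇx))
      where Pb-disjoint = components-disjoint T acyclic (proj₁ cb) (proj₁ ca) (a≢b ∘ sym)

  -- If p has a neighbour w in P ∩ A, exchanging on the component of w in T − pw shows that pw is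
  -- critical; otherwise glue P A S is a dissociation set of T.
  module CriticalNeighbour {P p q S A} (cross : SingleCrossing T P p q) (Pp : P p ≡ true) (Pq : P q ≡ false)
    (pq : Adj T p q) (A-diss : IsDissociation (deleteEdge T p q) A) (S-max : IsMaximumDissociation T S)
    (Sp : S p ≡ true) (Sq : S q ≡ true) where

    M : Fin n → Bool
    M = glue P A S

    PA-diss : IsDissociation T (P ∩ A)
    PA-diss = IsDissociation-∩-deleteEdge T P (inj₂ Pq) A-diss

    ∁PS-diss : IsDissociation T (∁ P ∩ S)
    ∁PS-diss = IsDissociation-∩ T (∁ P) (proj₁ S-max)

    q-lonely : ∀ y → (∁ P ∩ S) y ≡ true → ¬ Adj T q y
    q-lonely y ∁PSy qy with ∧-true⁻ ∁PSy
    ... | ∁Py , Sy with IsDissociation-neighbour-unique T (proj₁ S-max) Sq Sy qy Sp (adj-sym T pq)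
    ...   | refl = ≡true⇒≢false ∁Py (cong not Pp)

    without-neighbour : (∀ w → ((P ∩ A) ∩ adj T p) w ≢ true) → IsDissociation T M
    without-neighbour ∄w = glue-isDissociation T cross PA-diss ∁PS-diss
      λ _ _ _ → (λ y PAy py → ∄w y (∧-true⁺ PAy py)) , q-lonely

    module _ {w} (PApw : ((P ∩ A) ∩ adj T p) w ≡ true) where

      Pw : P w ≡ true
      Pw = proj₁ (∧-true⁻ {P w} (proj₁ (∧-true⁻ {P w ∧ A w} PApw)))
      Aw : A w ≡ true
      Aw = proj₂ (∧-true⁻ {P w} (proj₁ (∧-true⁻ {P w ∧ A w} PApw)))
      pw : Adj T p w
      pw = proj₂ (∧-true⁻ {P w ∧ A w} PApw)

      w≢q : w ≢ q
      w≢q refl = ≡true⇒≢false Pw Pq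

      W : Fin n → Bool
      W = component T w p

      W⊆P : W ⊆ P
      W⊆P = component-⊆ T cross Pw pw

      Sw : S w ≡ false
      Sw with S w in Sw
      ... | false = refl
      ... | true  = contradiction (IsDissociation-neighbour-unique T (proj₁ S-max) Sp Sw pw Sq pq) w≢q

      p-q-w : ∀ {y} → P y ≡ true → Adj T p y → Adj (deleteEdge T p q) p y
      p-q-w {y} Py py = deleteEdge-keeps T p q py λ
        { (inj₁ (_ , refl)) → ≡true⇒≢false Py Pq
        ; (inj₂ (refl , _)) → adj-irrefl T pq refl }

      M′ : Fin n → Bool
      M′ = glue P (A ∩ ∁ W) S

      M′-diss : IsDissociation T M′
      M′-diss = glue-isDissociation T cross (IsDissociation-⊆ T shrink PA-diss) ∁PS-diss
        λ _ A∁Wp _ → p-lonely (proj₁ (∧-true⁻ A∁Wp)) , q-lonely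
        where
        shrink : (P ∩ (A ∩ ∁ W)) ⊆ (P ∩ A)
        shrink x PA∁Wx = let (Px , A∁Wx) = ∧-true⁻ {P x} PA∁Wx in
          ∧-true⁺ Px (proj₁ (∧-true⁻ {A x} A∁Wx))
        p-lonely : A p ≡ true → ∀ y → (P ∩ (A ∩ ∁ W)) y ≡ true → ¬ Adj T p y
        p-lonely Ap y PA∁Wy py with ∧-true⁻ {P y} PA∁Wy
        ... | Py , A∁Wy with ∧-true⁻ {A y} A∁Wy
        ...   | Ay , ∁Wy with IsDissociation-neighbour-unique (deleteEdge T p q) A-diss Ap
                                Ay (p-q-w Py py) Aw (p-q-w Pw pw)
        ...     | refl = ≡true⇒≢false ∁Wy (cong not (component-source T w p))

      Z : Fin n → Bool
      Z = glue W A S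

      Z-diss : IsDissociation (deleteEdge T p w) Z
      Z-diss = glue-isDissociation-blocked (deleteEdge T p w)
        (SingleCrossing-deleteEdge T p w (crossing (adj-sym T pw)))
        (IsDissociation-deleteEdge⁺ T p w (IsDissociation-⊆ T W∩A⊆P∩A PA-diss))
        (IsDissociation-deleteEdge⁺ T p w (IsDissociation-∩ T (∁ W) (proj₁ S-max)))
        (inj₁ λ wp → deleteEdge-removes T p w (adj-sym (deleteEdge T p w) {w} {p} wp))
        where
        W∩A⊆P∩A : (W ∩ A) ⊆ (P ∩ A)
        W∩A⊆P∩A x WAx = let (Wx , Ax) = ∧-true⁻ WAx in ∧-true⁺ (W⊆P x Wx) Ax

      Z′ : Fin n → Bool
      Z′ = glue W S M

      Z′-diss : IsDissociation T Z′
      Z′-diss = glue-isDissociation-blocked T (crossing (adj-sym T pw))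
        (IsDissociation-∩ T W (proj₁ S-max)) (IsDissociation-⊆ T (∩-glue-⊆ (∁ W) P A S) M′-diss)
        (inj₂ (inj₁ Sw))

      exchange : count Z + count Z′ ≡ count M + count S
      exchange = count-pointwise pointwise
        where
        pointwise : ∀ x → bit (Z x) + bit (Z′ x) ≡ bit (M x) + bit (S x)
        pointwise x with W x in Wx
        ... | true  rewrite W⊆P x Wx = refl
        ... | false = +-comm (bit (S x)) (bit (M x))

      with-neighbour : count S < count M → Critical T p w
      with-neighbour S<M = larger⇒critical T pw Z-diss S-max (+-cancelʳ-< (count S) _ _ (begin-strict
        count S + count S   <⟨ +-monoˡ-< (count S) S<M ⟩
        count M + count S   ≡⟨ exchange ⟨
        count Z + count Z′  ≤⟨ +-monoʳ-≤ (count Z) (proj₂ S-max Z′ Z′-diss) ⟩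
        count Z + count S   ∎))
        where open ≤-Reasoning

  critical-neighbour : ∀ {P p q S A} → SingleCrossing T P p q → P p ≡ true → P q ≡ false → Adj T p q →
    IsDissociation (deleteEdge T p q) A → IsMaximumDissociation T S → S p ≡ true → S q ≡ true →
    count S < count (glue P A S) → ∃ λ w → w ≢ q × Critical T p w
  critical-neighbour {P} {p} {q} {S} {A} cross Pp Pq pq A-diss S-max Sp Sq S<M
    with any? (λ w → ((P ∩ A) ∩ adj T p) w ≟ᵇ true)
  ... | yes (w , PApw) = w , w≢q PApw , with-neighbour PApw S<M
    where open CriticalNeighbour cross Pp Pq pq A-diss S-max Sp Sq
  ... | no  ∄w = contradiction (proj₂ S-max _ (without-neighbour λ w PApw → ∄w (w , PApw))) (<⇒≱ S<M)
    where open CriticalNeighbour cross Pp Pq pq A-diss S-max Sp Sq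

  -- One of the two gluings of A and S along pq beats S, so critical-neighbour finds a second
  -- critical edge at p or at q.
  insulated-edge-split : ∀ {p q S} → Insulated T p q → IsMaximumDissociation T S → S p ≡ true → S q ≡ true → ⊥
  insulated-edge-split {p} {q} {S} (crit , p-alone , q-alone) S-max Sp Sq =
    [ p-side , q-side ] (glue-larger P A S S<A)
    where
    pq = proj₁ crit
    P = component T p q
    larger = critical⇒larger T crit S-max
    A = proj₁ larger
    A-diss = proj₁ (proj₂ larger)
    S<A = proj₂ (proj₂ larger)
    p-side : count S < count (glue P A S) → ⊥
    p-side S<glue =
      let (w , w≢q , pw) = critical-neighbour (crossing pq) (component-source T p q) (target-outside pq) pq
                             A-diss S-max Sp Sq S<glue
      in p-alone w w≢q pw
    q-side : count S < count (glue P S A) → ⊥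
    q-side S<glue =
      let (w , w≢p , qw) = critical-neighbour (SingleCrossing-∁ T (crossing pq)) (not-false (target-outside pq))
                             (source-outside p q) (adj-sym T pq) (IsDissociation-deleteEdge-comm T p q A-diss) S-max Sq Sp
                             (subst (count S <_) (count-cong (λ x → sym (glue-∁ P S A x))) S<glue)
      in q-alone w w≢p qw

  -- The branches at v are the components of T − v; branch v S w is the part of S in the branch
  -- through the neighbour w.
  branch : Fin n → (Fin n → Bool) → Fin n → Fin n → Bool
  branch v S w x = adj T v w ∧ (component T w v ∩ S) x

  branchesThrough : Fin n → (Fin n → Bool) → Fin n → ℕ
  branchesThrough v S x = count λ w → branch v S w x

  branchesThrough-≤1 : ∀ v S x → branchesThrough v S x ≤ 1
  branchesThrough-≤1 v S x = unique-count≤1 same-branch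
    where
    same-branch : ∀ w w′ → branch v S w x ≡ true → branch v S w′ x ≡ true → w ≡ w′
    same-branch w w′ in-w in-w′ with w ≟ w′ | ∧-true⁻ {adj T v w} in-w | ∧-true⁻ {adj T v w′} in-w′
    ... | yes w≡w′ | _ | _ = w≡w′
    ... | no  w≢w′ | vw , w-x | vw′ , w′-x = ⊥-elim (≡true⇒≢false (∩-⊆ˡ (component T w v) S x w-x)
      (components-disjoint T acyclic vw vw′ w≢w′ x (∩-⊆ˡ (component T w′ v) S x w′-x)))

  branchesThrough-centre : ∀ v S → branchesThrough v S v ≡ 0
  branchesThrough-centre v S = count-empty outside
    where
    outside : ∀ w → branch v S w v ≡ false
    outside w with adj T v w in vw
    ... | false = refl
    ... | true rewrite target-outside (adj-sym T vw) = refl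

  branchesThrough-pos : Connected T → ∀ {v S x} → S x ≡ true → x ≢ v → 1 ≤ branchesThrough v S x
  branchesThrough-pos connected {v} {S} {x} Sx x≢v =
    let (w , vw , wx) = component-cover T (connected x v) x≢v in count-pos {v = w} (∧-true⁺ vw (∧-true⁺ wx Sx))

  branchesThrough-out : ∀ {v S x} → S x ≡ false → branchesThrough v S x ≡ 0
  branchesThrough-out {v} {S} {x} Sx = count-empty outside
    where
    outside : ∀ w → branch v S w x ≡ false
    outside w rewrite Sx | ∧-zeroʳ (component T w v x) = ∧-zeroʳ (adj T v w)

  sum-branches : ∀ v S → sum (λ w → count (branch v S w)) ≡ sum (branchesThrough v S)
  sum-branches v S = ∑-comm (λ w x → bit (branch v S w x))

  count-≤-branches : Connected T → ∀ {v S} → S v ≡ false → count S ≤ sum (λ w → count (branch v S w))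
  count-≤-branches connected {v} {S} Sv = subst (count S ≤_) (sym (sum-branches v S)) (sum-mono-≤ covered)
    where
    covered : ∀ x → bit (S x) ≤ branchesThrough v S x
    covered x = bit-≤ λ Sx → branchesThrough-pos connected {v} {S} Sx λ { refl → ≡true⇒≢false Sx Sv }

  branches-<-count : ∀ {v S} → S v ≡ true → sum (λ w → count (branch v S w)) < count S
  branches-<-count {v} {S} Sv = begin-strict
    sum (λ w → count (branch v S w))                   ≡⟨ sum-branches v S ⟩
    sum (branchesThrough v S)                          <⟨ n<1+n _ ⟩
    suc (sum (branchesThrough v S))                    ≡⟨ +-comm 1 _ ⟩
    sum (branchesThrough v S) + 1                      ≡⟨ cong (sum (branchesThrough v S) +_) (count-⁅⁆ v) ⟨
    sum (branchesThrough v S) + count ⁅ v ⁆            ≡⟨ ∑-distrib-+ (branchesThrough v S) (λ x → bit (⁅ v ⁆ x)) ⟨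
    sum (λ x → branchesThrough v S x + bit (⁅ v ⁆ x))  ≤⟨ sum-mono-≤ disjoint ⟩
    count S                                            ∎
    where
    open ≤-Reasoning
    disjoint : ∀ x → branchesThrough v S x + bit (⁅ v ⁆ x) ≤ bit (S x)
    disjoint x with x ≟ v
    ... | yes refl rewrite branchesThrough-centre v S | Sv = ≤-refl
    ... | no  _    = subst (_≤ bit (S x)) (sym (+-identityʳ _))
                       (≤-bit (branchesThrough-≤1 v S x) (branchesThrough-out {v} {S}))

  -- If no branch at v carries more vertices of S₂ than of S₁, summing over the branches gives
  -- |S₂| < |S₁| because v ∈ S₁ ∖ S₂.
  differing-vertex-critical : Connected T → ∀ {v S₁ S₂} → IsMaximumDissociation T S₁ → IsMaximumDissociation T S₂ →
    S₁ v ≡ true → S₂ v ≡ false → ∃ λ w → Critical T w v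
  differing-vertex-critical connected {v} {S₁} {S₂} S₁-max S₂-max S₁v S₂v
    with any? (λ w → (adj T v w ≟ᵇ true) ×-dec (count (component T w v ∩ S₁) <? count (component T w v ∩ S₂)))
  ... | yes (w , vw , gain) = w , larger⇒critical T wv Z-diss S₁-max (glue-count-gain C S₂ S₁ gain)
    where
    wv = adj-sym T vw
    C = component T w v
    Z-diss : IsDissociation (deleteEdge T w v) (glue C S₂ S₁)
    Z-diss = glue-isDissociation-blocked (deleteEdge T w v)
      (SingleCrossing-deleteEdge T w v (crossing wv))
      (IsDissociation-deleteEdge⁺ T w v (IsDissociation-∩ T C (proj₁ S₂-max)))
      (IsDissociation-deleteEdge⁺ T w v (IsDissociation-∩ T (∁ C) (proj₁ S₁-max)))
      (inj₁ (deleteEdge-removes T w v))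
  ... | no ∄w = ⊥-elim (<-irrefl refl (begin-strict
    count S₂                            ≤⟨ count-≤-branches connected S₂v ⟩
    sum (λ w → count (branch v S₂ w))   ≤⟨ sum-mono-≤ no-gain ⟩
    sum (λ w → count (branch v S₁ w))   <⟨ branches-<-count S₁v ⟩
    count S₁                            ≤⟨ proj₂ S₂-max S₁ (proj₁ S₁-max) ⟩
    count S₂                            ∎))
    where
    open ≤-Reasoning
    no-gain : ∀ w → count (branch v S₂ w) ≤ count (branch v S₁ w)
    no-gain w with adj T v w in vw
    ... | false = ≤-refl
    ... | true  = ≮⇒≥ λ gain → ∄w (w , vw , gain)

  critical-path-pattern : ∀ {a c b S} → Critical T c a → Critical T c b → a ≢ b → IsMaximumDissociation T S →
    (S a ∨ S b) ≡ true × S c ≡ not (S a ∧ S b)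
  critical-path-pattern {a} {c} {b} {S} ca cb a≢b S-max with S a in Sa | S b in Sb | S c in Sc
  ... | true  | true  | false = refl , refl
  ... | true  | false | true  = refl , refl
  ... | false | true  | true  = refl , refl
  ... | true  | true  | true  = ⊥-elim (a≢b (IsDissociation-neighbour-unique T (proj₁ S-max) Sc Sa (proj₁ ca) Sb (proj₁ cb)))
  ... | true  | false | false = ⊥-elim (critical-edge-covered cb S-max Sc Sb)
  ... | false | true  | false = ⊥-elim (critical-edge-covered ca S-max Sc Sa)
  ... | false | false | false = ⊥-elim (critical-edge-covered ca S-max Sc Sa)
  ... | false | false | true  = ⊥-elim (critical-path-centre ca cb a≢b S-max Sc Sa Sb)

  insulated-edge-pattern : ∀ {u v S} → Insulated T u v → IsMaximumDissociation T S → S v ≡ not (S u)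
  insulated-edge-pattern {u} {v} {S} insulated S-max with S u in Su | S v in Sv
  ... | true  | false = refl
  ... | false | true  = refl
  ... | true  | true  = ⊥-elim (insulated-edge-split insulated S-max Su Sv)
  ... | false | false = ⊥-elim (critical-edge-covered (proj₁ insulated) S-max Su Sv)


-- Encoding maximum dissociation sets

-- On a critical 3-path a–c–b a maximum dissociation set is determined by its values at a and b,
-- which are not both false, so three digits suffice.
pathCode : Bool → Bool → Fin 3
pathCode true  true  = zero
pathCode true  false = suc zero
pathCode false _     = suc (suc zero)

pathCode-injective : ∀ {a b a′ b′} → (a ∨ b) ≡ true → (a′ ∨ b′) ≡ true → pathCode a b ≡ pathCode a′ b′ → a ≡ a′ × b ≡ b′
pathCode-injective {true}  {true}  {true}  {true}  _ _ _ = refl , refl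
pathCode-injective {true}  {false} {true}  {false} _ _ _ = refl , refl
pathCode-injective {false} {true}  {false} {true}  _ _  _ = refl , refl
pathCode-injective {false} {true}  {false} {false} _ () _

edgeCode : Bool → Fin 2
edgeCode true  = zero
edgeCode false = suc zero

edgeCode-injective : ∀ {a b} → edgeCode a ≡ edgeCode b → a ≡ b
edgeCode-injective {true}  {true}  _ = refl
edgeCode-injective {false} {false} _ = refl

funToFin-injective : ∀ {m k} {f g : Fin m → Fin k} → funToFin f ≡ funToFin g → ∀ i → f i ≡ g i
funToFin-injective {f = f} {g} eq i =
  trans (sym (finToFun-funToFin f i)) (trans (cong (λ c → finToFun c i) eq) (finToFun-funToFin g i))

OnPath : ∀ {n} → Fin n → Fin n × Fin n × Fin n → Set
OnPath v (a , c , b) = v ≡ a ⊎ v ≡ c ⊎ v ≡ b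

OnEdge : ∀ {n} → Fin n → Fin n × Fin n → Set
OnEdge v (u , w) = v ≡ u ⊎ v ≡ w

onPath? : ∀ {n} (v : Fin n) t → Dec (OnPath v t)
onPath? v (a , c , b) = (v ≟ a) ⊎-dec ((v ≟ c) ⊎-dec (v ≟ b))

∈⇒index : ∀ {A : Set} {x : A} {xs : List A} → x ∈ᴸ xs → ∃ λ i → lookup xs i ≡ x
∈⇒index x∈ = Any.index x∈ , sym (lookup-index x∈)

module Encoding {n} (T : Graph n) (acyclic : Acyclic T)
  (paths : List (Fin n × Fin n × Fin n)) (paths-spec : ∀ t → (t ∈ᴸ paths) ⇔ Critical3Path T t)
  (edges : List (Fin n × Fin n)) (edges-spec : ∀ e → (e ∈ᴸ edges) ⇔ InsulatedEdge T e) where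

  pathDigits : (Fin n → Bool) → Fin (3 ^ length paths)
  pathDigits S = funToFin λ i → let (a , _ , b) = lookup paths i in pathCode (S a) (S b)

  edgeDigits : (Fin n → Bool) → Fin (2 ^ length edges)
  edgeDigits S = funToFin λ j → let (u , _) = lookup edges j in edgeCode (S u)

  code : (Fin n → Bool) → Fin (3 ^ length paths * 2 ^ length edges)
  code S = combine (pathDigits S) (edgeDigits S)

  listed-path : ∀ i → Critical3Path T (lookup paths i)
  listed-path i = Equivalence.to (paths-spec _) (∈-lookup i)

  listed-edge : ∀ j → InsulatedEdge T (lookup edges j)
  listed-edge j = Equivalence.to (edges-spec _) (∈-lookup j)

  path-through : ∀ {a c b} → Critical T c a → Critical T c b → a ≢ b →
    ∀ {v} → OnPath v (a , c , b) → ∃ λ i → OnPath v (lookup paths i)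
  path-through {a} {c} {b} ca cb a≢b {v} on with <-cmp (toℕ a) (toℕ b)
  ... | tri< a<b _ _ = let (i , at-i) = ∈⇒index (Equivalence.from (paths-spec _) (a<b , ca , cb)) in
    i , subst (OnPath v) (sym at-i) on
  ... | tri≈ _ a≡b _ = contradiction (toℕ-injective a≡b) a≢b
  ... | tri> _ _ b<a = let (i , at-i) = ∈⇒index (Equivalence.from (paths-spec _) (b<a , cb , ca)) in
    i , subst (OnPath v) (sym at-i) (reverse on)
    where
    reverse : OnPath v (a , c , b) → OnPath v (b , c , a)
    reverse (inj₁ v≡a)        = inj₂ (inj₂ v≡a)
    reverse (inj₂ (inj₁ v≡c)) = inj₂ (inj₁ v≡c)
    reverse (inj₂ (inj₂ v≡b)) = inj₁ v≡b

  edge-through : ∀ {u w} → Insulated T u w → ∀ {v} → OnEdge v (u , w) → ∃ λ j → OnEdge v (lookup edges j)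
  edge-through {u} {w} insulated@(uw , u-alone , w-alone) {v} on with <-cmp (toℕ u) (toℕ w)
  ... | tri< u<w _ _ = let (j , at-j) = ∈⇒index (Equivalence.from (edges-spec _) (u<w , insulated)) in
    j , subst (OnEdge v) (sym at-j) on
  ... | tri≈ _ u≡w _ = contradiction (toℕ-injective u≡w) (adj-irrefl T (proj₁ uw))
  ... | tri> _ _ w<u =
    let (j , at-j) = ∈⇒index (Equivalence.from (edges-spec _) (w<u , Critical-sym T uw , w-alone , u-alone)) in
    j , subst (OnEdge v) (sym at-j) (reverse on)
    where
    reverse : OnEdge v (u , w) → OnEdge v (w , u)
    reverse (inj₁ v≡u) = inj₂ v≡u
    reverse (inj₂ v≡w) = inj₁ v≡w

  critical-edge-listed : ∀ {w v} → Critical T w v →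
    (∃ λ i → OnPath v (lookup paths i)) ⊎ (∃ λ j → OnEdge v (lookup edges j))
  critical-edge-listed {w} {v} wv with any? (λ i → onPath? v (lookup paths i))
  ... | yes on-path = inj₁ on-path
  ... | no  ∄path   = inj₂ (edge-through (vw , v-alone , w-alone) (inj₁ refl))
    where
    vw = Critical-sym T wv
    v-alone : ∀ w′ → w′ ≢ w → ¬ Critical T v w′
    v-alone w′ w′≢w vw′ = ∄path (path-through vw vw′ (w′≢w ∘ sym) (inj₂ (inj₁ refl)))
    w-alone : ∀ w′ → w′ ≢ v → ¬ Critical T w w′
    w-alone w′ w′≢v ww′ = ∄path (path-through wv ww′ (w′≢v ∘ sym) (inj₁ refl))

  module _ {S₁ S₂} (S₁-max : IsMaximumDissociation T S₁) (S₂-max : IsMaximumDissociation T S₂)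
    (same-code : code S₁ ≡ code S₂) where

    same-digits : pathDigits S₁ ≡ pathDigits S₂ × edgeDigits S₁ ≡ edgeDigits S₂
    same-digits = combine-injective (pathDigits S₁) (edgeDigits S₁) (pathDigits S₂) (edgeDigits S₂) same-code

    path-digit : ∀ i → let (a , _ , b) = lookup paths i in pathCode (S₁ a) (S₁ b) ≡ pathCode (S₂ a) (S₂ b)
    path-digit = funToFin-injective (proj₁ same-digits)

    edge-digit : ∀ j → let (u , _) = lookup edges j in edgeCode (S₁ u) ≡ edgeCode (S₂ u)
    edge-digit = funToFin-injective (proj₂ same-digits)

    path-agrees : ∀ {a c b} → Critical3Path T (a , c , b) → pathCode (S₁ a) (S₁ b) ≡ pathCode (S₂ a) (S₂ b) →
      S₁ a ≡ S₂ a × S₁ c ≡ S₂ c × S₁ b ≡ S₂ b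
    path-agrees (a<b , ca , cb) digit =
      a-agrees , trans centre₁ (trans (cong₂ (λ x y → not (x ∧ y)) a-agrees b-agrees) (sym centre₂)) , b-agrees
      where
      a≢b = λ a≡b → <-irrefl (cong toℕ a≡b) a<b
      pattern₁ = critical-path-pattern T acyclic ca cb a≢b S₁-max
      pattern₂ = critical-path-pattern T acyclic ca cb a≢b S₂-max
      centre₁ = proj₂ pattern₁
      centre₂ = proj₂ pattern₂
      ends = pathCode-injective (proj₁ pattern₁) (proj₁ pattern₂) digit
      a-agrees = proj₁ ends
      b-agrees = proj₂ ends

    edge-agrees : ∀ {u w} → InsulatedEdge T (u , w) → edgeCode (S₁ u) ≡ edgeCode (S₂ u) → S₁ u ≡ S₂ u × S₁ w ≡ S₂ w
    edge-agrees (_ , insulated) digit = u-agrees ,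
      trans (insulated-edge-pattern T acyclic insulated S₁-max)
        (trans (cong not u-agrees) (sym (insulated-edge-pattern T acyclic insulated S₂-max)))
      where u-agrees = edgeCode-injective digit

    agree-on-path : ∀ i {v} → OnPath v (lookup paths i) → S₁ v ≡ S₂ v
    agree-on-path i (inj₁ refl)        = proj₁ (path-agrees (listed-path i) (path-digit i))
    agree-on-path i (inj₂ (inj₁ refl)) = proj₁ (proj₂ (path-agrees (listed-path i) (path-digit i)))
    agree-on-path i (inj₂ (inj₂ refl)) = proj₂ (proj₂ (path-agrees (listed-path i) (path-digit i)))

    agree-on-edge : ∀ j {v} → OnEdge v (lookup edges j) → S₁ v ≡ S₂ v
    agree-on-edge j (inj₁ refl) = proj₁ (edge-agrees (listed-edge j) (edge-digit j))
    agree-on-edge j (inj₂ refl) = proj₂ (edge-agrees (listed-edge j) (edge-digit j))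

    agree-on-critical : ∀ {w v} → Critical T w v → S₁ v ≡ S₂ v
    agree-on-critical wv with critical-edge-listed wv
    ... | inj₁ (i , on) = agree-on-path i on
    ... | inj₂ (j , on) = agree-on-edge j on

    agree : Connected T → ∀ v → S₁ v ≡ S₂ v
    agree connected v with S₁ v in S₁v | S₂ v in S₂v
    ... | true  | true  = refl
    ... | false | false = refl
    ... | true  | false = trans (sym S₁v) (trans (agree-on-critical (proj₂ differs)) S₂v)
      where differs = differing-vertex-critical T acyclic connected S₁-max S₂-max S₁v S₂v
    ... | false | true  = trans (sym S₁v) (trans (agree-on-critical (proj₂ differs)) S₂v)
      where differs = differing-vertex-critical T acyclic connected S₂-max S₁-max S₂v S₁v

lemma4p1 : ∀ {n : ℕ} (T : Graph n) → IsTree T →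
    ∀ (k x y : ℕ) →
    (F : Subset n) → ∣ F ∣ ≡ k → (∀ v → (v ∈ F) ⇔ Flexible T v) →
    HasExactly (Critical3Path T) x →
    3 * x + 2 * y ≡ k →
    HasExactly (InsulatedEdge T) y →
    ∀ (L : List (Subset n)) → Unique L → All (MaxDissociation T) L →
    length L ≤ 3 ^ x * 2 ^ y
lemma4p1 T (_ , connected , acyclic) k x y F _ _ (paths , _ , #paths , paths-spec) _ (edges , _ , #edges , edges-spec)
         L L! L-max =
  subst₂ (λ a b → length L ≤ 3 ^ a * 2 ^ b) #paths #edges (length≤-injective (code ∘ Vec.lookup) L! same-code⇒same)
  where
  open Encoding T acyclic paths paths-spec edges edges-spec
  maximum : ∀ {S} → S ∈ᴸ L → IsMaximumDissociation T (Vec.lookup S)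
  maximum S∈L = maxDissociation-lookup T (All.lookup L-max S∈L)
  same-code⇒same : ∀ {S₁ S₂} → S₁ ∈ᴸ L → S₂ ∈ᴸ L → code (Vec.lookup S₁) ≡ code (Vec.lookup S₂) → S₁ ≡ S₂
  same-code⇒same {S₁} {S₂} S₁∈L S₂∈L same = begin
    S₁                        ≡⟨ tabulate∘lookup S₁ ⟨
    tabulate (Vec.lookup S₁)  ≡⟨ tabulate-cong (agree (maximum S₁∈L) (maximum S₂∈L) same connected) ⟩
    tabulate (Vec.lookup S₂)  ≡⟨ tabulate∘lookup S₂ ⟩
    S₂                        ∎
    where open ≡-Reasoning
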